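{- Let $k\ge1$, $w\in S_{k+1}$, and $(I_1,\dots,I_{k+1})=\mathrm{Inv}(w_\circ w)$. For $i\in[k-1]$, the number $n_i$ of parts of size $i$ in $\theta(w)$ satisfies \[ n_i=\begin{cases}I_i-I_{i+1}-1 & \text{if } i\notin D(w),\\ k-i+I_i-I_{i+1} & \text{if } i\in D(w),\end{cases} \] and $n_i=m_i$, where $w=c_k^{m_0}c_{k-1}^{m_1}\cdots c_1^{m_{k-1}}$ is the unique factorization with $0\le m_i\le k-i$ for $i=0,\dots,k-1$.
   Context: Permutations $w\in S_{k+1}$ are written in one-line notation $w=w_1\cdots w_{k+1}$; products are compositions of functions, so right multiplication by the simple transposition $s_i=(i\ i{+}1)$ swaps the entries in positions $i,i+1$. $w_\circ$ is the longest element. $\mathrm{Inv}(w)=(\mathrm{Inv}_1(w),\dots,\mathrm{Inv}_{k+1}(w))$ with $\mathrm{Inv}_i(w)=\#\{j>i:w_i>w_j\}$; $D(w)=\{i:w_i>w_{i+1}\}$. $c_i=s_{k+1-i}\cdots s_k$. The $k$-rectangles are $R_i=(i^{k+1-i})$, $i\in[k]$. A partition with parts $\le k$ is irreducible if it has at most $k-i$ parts equal to $i$ for each $i$; for a partition $\mu$ with parts $\le k$, $\mu_\downarrow$ is the irreducible partition obtained by removing (the parts of) as many $k$-rectangles as possible. $\zeta(w)$ is the partition whose $i$-th column has length $\binom{k+1-i}{2}+\mathrm{Inv}_i(w_\circ w)$ for $i\in[k]$, and $\theta(w)=\zeta(w)_\downarrow$. -}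

module Defs where

open import Data.Nat using (ℕ; zero; suc; _+_; _∸_; _<_; _≤_; _<?_; _≤?_; _%_)
open import Data.Nat.Combinatorics using (_C_)
open import Data.List using (List; []; _∷_; map; upTo; reverse; filter; drop; length; concat; replicate; foldl)
open import Data.Bool using (if_then_else_)
open import Relation.Nullary.Decidable using (⌊_⌋)

-- Permutations w ∈ S_{k+1} are represented in one-line notation as lists
-- w = w₁ ⋯ w_{k+1} of natural numbers (which are required elsewhere to be
-- a permutation of [1..k+1]).  Positions and values are 1-indexed.

idPerm : ℕ → List ℕ
idPerm k = map suc (upTo (suc k))

w₀ : ℕ → List ℕ
w₀ k = reverse (idPerm k)

-- 1-indexed entry w_p (0 when out of range)
at : List ℕ → ℕ → ℕ
at []       _             = 0
at (x ∷ xs) zero          = 0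
at (x ∷ xs) (suc zero)    = x
at (x ∷ xs) (suc (suc p)) = at xs (suc p)

_∘ₗ_ : List ℕ → List ℕ → List ℕ
u ∘ₗ w = map (at u) w

Inv : List ℕ → ℕ → ℕ
Inv w i = length (filter (λ x → x <? at w i) (drop i w))

Desc : List ℕ → ℕ → Set
Desc w i = at w (suc i) < at w i

-- right multiplication by s_i: swap the entries in positions i, i+1
swapAt : ℕ → List ℕ → List ℕ
swapAt (suc zero)    (x ∷ y ∷ xs) = y ∷ x ∷ xs
swapAt (suc (suc i)) (x ∷ xs)     = x ∷ swapAt (suc i) xs
swapAt _             xs           = xs

evalWord : ℕ → List ℕ → List ℕ
evalWord k ws = foldl (λ w a → swapAt a w) (idPerm k) ws

-- c_i = s_{k+1-i} ⋯ s_k  (as a word of length i)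
cWord : ℕ → ℕ → List ℕ
cWord k i = map (λ t → (k + 1 ∸ i) + t) (upTo i)

-- the word for c_k^{m_0} c_{k-1}^{m_1} ⋯ c_1^{m_{k-1}}
factWord : ℕ → (ℕ → ℕ) → List ℕ
factWord k m = concat (map (λ j → concat (replicate (m j) (cWord k (k ∸ j)))) (upTo k))

-- Partitions with parts ≤ k are represented by their multiplicity
-- functions: μ i = number of parts equal to i (for i ∈ [k]).

-- length of the i-th column of ζ(w) (i ∈ [k]; 0 for i > k):
-- binom(k+1-i, 2) + Inv_i(w∘ w)
zetaCol : ℕ → List ℕ → ℕ → ℕ
zetaCol k w i = if ⌊ i ≤? k ⌋ then ((k + 1 ∸ i) C 2) + Inv (w₀ k ∘ₗ w) i else 0

-- number of parts equal to i in ζ(w)  (= c_i - c_{i+1} for column lengths c)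
zetaMult : ℕ → List ℕ → ℕ → ℕ
zetaMult k w i = zetaCol k w i ∸ zetaCol k w (suc i)

-- μ_↓ : the k-rectangle R_i = (i^{k+1-i}) consists of exactly k+1-i parts
-- equal to i, so removing as many k-rectangles as possible leaves
-- (μ i mod (k+1-i)) parts equal to i, for each i ∈ [k].
reduce : ℕ → (ℕ → ℕ) → (ℕ → ℕ)
reduce k μ i = μ i % suc (k ∸ i)

thetaMult : ℕ → List ℕ → ℕ → ℕ
thetaMult k w = reduce k (zetaMult k w)

module Submission where

-- Since w∘ reverses values, Inv_p(w∘w) counts the entries of w after position p
-- that exceed w_p (Inv-w₀∘).  Consecutive columns of ζ(w) differ by binomials,
-- so after removing k-rectangles n_i is the residue
-- ((k-i) + Inv_i - Inv_{i+1}) mod (k-i+1) (thetaMult-Inv).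
-- (1) With x = w_i, y = w_{i+1} followed by k-i further entries, both counts live
--     in this window; as x ≠ y, comparing them evaluates the residue (Window).
-- (2) c_{k-j} = s_{j+1} ⋯ s_k rotates the last k+1-j entries once, so the
--     factorization acts on the identity as a cascade of rotations
--     (evalWord-factWord).  Each tail of the cascade lists the remaining letters in
--     increasing cyclic order starting after the letter just fixed (SortedAfter),
--     and there the residue is exactly the rotation amount (cyclic-offset), which
--     gives n_i = m_i (residue-cascade).

module Lemmas where

  open import Defs
  open import Data.Nat using (ℕ; zero; suc; _+_; _≤_; _<_; _∸_; _<?_; _≤?_; z≤n; s≤s; z<s; _%_)
  open import Data.Nat.Properties
  open import Data.Nat.Combinatorics using (_C_; nC1≡n; nCk+nC[k+1]≡[n+1]C[k+1])
  open import Data.Nat.Tactic.RingSolver using (solve-∀)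
  open import Data.Nat.DivMod using (m≤n⇒m%n≡m; [m+n]%n≡m%n)
  open import Data.Integer using (+_; _-_; 1ℤ; _⊖_; -_) renaming (_+_ to _+ℤ_)
  open import Data.Integer.Properties using (m-n≡m⊖n; ⊖-≥) renaming (+-assoc to +ℤ-assoc)
  open import Data.List using (List; []; _∷_; _++_; [_]; length; filter; drop; map; reverse; upTo; applyUpTo; applyDownFrom; foldl; concat; replicate)
  open import Data.List.Properties
    using (filter-++; length-++; length-filter; filter-accept; filter-reject; drop-map; length-drop;
           map-upTo; reverse-applyUpTo; length-map; length-upTo; ++-assoc; ++-identityʳ; foldl-++; ∷-injective)
  open import Data.List.Relation.Unary.All as All using (All; []; _∷_)
  open import Data.List.Relation.Unary.All.Properties using (drop⁺) renaming (++⁺ to All-++⁺)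
  open import Data.List.Relation.Unary.AllPairs using (AllPairs; []; _∷_)
  import Data.List.Relation.Unary.AllPairs.Properties as AllPairs
  open import Data.List.Relation.Unary.Unique.Propositional using (Unique)
  open import Data.List.Relation.Unary.Unique.Propositional.Properties using (map⁺; upTo⁺)
  open import Data.List.Relation.Binary.Permutation.Propositional using (_↭_; ↭-refl; ↭-sym; ↭-trans; prep; ↭⇒↭ₛ)
  open import Data.List.Relation.Binary.Permutation.Propositional.Properties using (filter-↭; ↭-length; All-resp-↭; ++-comm)
  open import Data.Product using (Σ-syntax; _×_; _,_; proj₁; proj₂)
  open import Data.Bool using (if_then_else_)
  open import Function using (_∘_)
  open import Relation.Nullary using (¬_; yes; no; contradiction)
  open import Relation.Nullary.Decidable using (dec-true; isYes≗does)
  open import Relation.Binary.PropositionalEquality hiding ([_])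
  open import Data.List.Relation.Binary.Permutation.Setoid.Properties (setoid ℕ) using (Unique-resp-↭)

  -- above c xs : the number of entries of xs exceeding c.  Every count in the
  -- theorem (the inversion numbers of w∘w, hence θ(w)) is such a count.
  above : ℕ → List ℕ → ℕ
  above c xs = length (filter (c <?_) xs)

  above-∷-> : ∀ {c y} xs → c < y → above c (y ∷ xs) ≡ suc (above c xs)
  above-∷-> {c} xs c<y = cong length (filter-accept (c <?_) {xs = xs} c<y)

  above-∷-≯ : ∀ {c y} xs → ¬ c < y → above c (y ∷ xs) ≡ above c xs
  above-∷-≯ {c} xs c≮y = cong length (filter-reject (c <?_) {xs = xs} c≮y)

  above-++ : ∀ c xs ys → above c (xs ++ ys) ≡ above c xs + above c ys
  above-++ c xs ys = trans (cong length (filter-++ (c <?_) xs ys)) (length-++ (filter (c <?_) xs))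

  above-all : ∀ {c xs} → All (c <_) xs → above c xs ≡ length xs
  above-all {xs = []} [] = refl
  above-all {xs = x ∷ xs} (c<x ∷ ps) = trans (above-∷-> xs c<x) (cong suc (above-all ps))

  above-none : ∀ {c xs} → All (_< c) xs → above c xs ≡ 0
  above-none {xs = []} [] = refl
  above-none {xs = x ∷ xs} (x<c ∷ ps) = trans (above-∷-≯ xs (<-asym x<c)) (above-none ps)

  above-↭ : ∀ c {xs ys} → xs ↭ ys → above c xs ≡ above c ys
  above-↭ c p = ↭-length (filter-↭ (c <?_) p)

  above-≤-length : ∀ c xs → above c xs ≤ length xs
  above-≤-length c xs = length-filter (c <?_) xs

  above-antitone : ∀ {c d} → c ≤ d → ∀ xs → above d xs ≤ above c xs
  above-antitone c≤d [] = z≤n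
  above-antitone {c} {d} c≤d (x ∷ xs) with d <? x | c <? x
  ... | yes d<x | yes c<x rewrite above-∷-> xs d<x | above-∷-> xs c<x = s≤s (above-antitone c≤d xs)
  ... | yes d<x | no c≮x  = contradiction (≤-<-trans c≤d d<x) c≮x
  ... | no d≮x  | yes c<x rewrite above-∷-≯ xs d≮x | above-∷-> xs c<x = m≤n⇒m≤1+n (above-antitone c≤d xs)
  ... | no d≮x  | no c≮x  rewrite above-∷-≯ xs d≮x | above-∷-≯ xs c≮x = above-antitone c≤d xs

  below-image-reversed : ∀ (f : ℕ → ℕ) c xs →
    All (λ v → (c < v → f v < f c) × (f v < f c → c < v)) xs →
    length (filter (_<? f c) (map f xs)) ≡ above c xs
  below-image-reversed f c [] [] = refl
  below-image-reversed f c (x ∷ xs) ((to , from) ∷ rev) with c <? x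
  ... | yes c<x = trans (cong length (filter-accept (_<? f c) {xs = map f xs} (to c<x)))
                        (trans (cong suc (below-image-reversed f c xs rev)) (sym (above-∷-> xs c<x)))
  ... | no c≮x  = trans (cong length (filter-reject (_<? f c) {xs = map f xs} (c≮x ∘ from)))
                        (trans (below-image-reversed f c xs rev) (sym (above-∷-≯ xs c≮x)))

  range : ℕ → ℕ → List ℕ
  range s zero    = []
  range s (suc n) = s ∷ range (suc s) n

  applyUpTo-range : ∀ (f : ℕ → ℕ) s n → (∀ t → f t ≡ s + t) → applyUpTo f n ≡ range s n
  applyUpTo-range f s zero    f≗ = refl
  applyUpTo-range f s (suc n) f≗ =
    cong₂ _∷_ (trans (f≗ 0) (+-identityʳ s))
              (applyUpTo-range (f ∘ suc) (suc s) n (λ t → trans (f≗ (suc t)) (+-suc s t)))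

  range-bounds : ∀ s n → All (λ v → s ≤ v × v < s + n) (range s n)
  range-bounds s zero    = []
  range-bounds s (suc n) = (≤-refl , m<m+n s z<s) ∷ All.map shift (range-bounds (suc s) n)
    where
    shift : ∀ {v} → suc s ≤ v × v < suc s + n → s ≤ v × v < s + suc n
    shift (s<v , v<) = <⇒≤ s<v , ≤-trans v< (≤-reflexive (sym (+-suc s n)))

  Increasing : List ℕ → Set
  Increasing = AllPairs _<_

  range-increasing : ∀ s n → Increasing (range s n)
  range-increasing s zero    = []
  range-increasing s (suc n) = All.map proj₁ (range-bounds (suc s) n) ∷ range-increasing (suc s) n

  idPerm-range : ∀ k → idPerm k ≡ range 1 (suc k)
  idPerm-range k = trans (map-upTo suc (suc k)) (applyUpTo-range suc 1 (suc k) (λ t → refl))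

  InRange : ℕ → ℕ → Set
  InRange k v = 1 ≤ v × v ≤ suc k

  perm-length : ∀ {k w} → w ↭ idPerm k → length w ≡ suc k
  perm-length {k} w↭id = trans (↭-length w↭id) (trans (length-map suc (upTo (suc k))) (length-upTo (suc k)))

  perm-InRange : ∀ {k w} → w ↭ idPerm k → All (InRange k) w
  perm-InRange {k} w↭id = All-resp-↭ (↭-sym w↭id) (subst (All (InRange k)) (sym (idPerm-range k)) letters)
    where
    letters : All (InRange k) (range 1 (suc k))
    letters = All.map (λ { (1≤v , v<k+2) → 1≤v , ≤-pred v<k+2 }) (range-bounds 1 (suc k))

  perm-Unique : ∀ {k w} → w ↭ idPerm k → Unique w
  perm-Unique {k} w↭id = Unique-resp-↭ (↭⇒↭ₛ (↭-sym w↭id)) (map⁺ suc-injective (upTo⁺ (suc k)))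

  at-w₀ : ∀ k {v} → InRange k v → at (w₀ k) v ≡ suc (suc k) ∸ v
  at-w₀ k {v} (1≤v , v≤) = trans (cong (λ l → at l v) w₀-down) (at-down (suc k) v 1≤v v≤)
    where
    w₀-down : w₀ k ≡ applyDownFrom suc (suc k)
    w₀-down = trans (cong reverse (map-upTo suc (suc k))) (reverse-applyUpTo suc (suc k))
    at-down : ∀ n v → 1 ≤ v → v ≤ n → at (applyDownFrom suc n) v ≡ suc n ∸ v
    at-down (suc n) (suc zero)    _ _         = refl
    at-down (suc n) (suc (suc v)) _ (s≤s v≤n) = at-down n (suc v) (s≤s z≤n) v≤n

  w₀-reverses : ∀ k {c v} → InRange k c → InRange k v →
    (c < v → at (w₀ k) v < at (w₀ k) c) × (at (w₀ k) v < at (w₀ k) c → c < v)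
  w₀-reverses k {c} {v} c∈ v∈ rewrite at-w₀ k c∈ | at-w₀ k v∈ =
    (λ c<v → ∸-monoʳ-< c<v (m≤n⇒m≤1+n (proj₂ v∈))) ,
    (λ lt → ≰⇒> (λ v≤c → <⇒≱ lt (∸-monoʳ-≤ (suc (suc k)) v≤c)))

  at-zero : ∀ l → at l 0 ≡ 0
  at-zero []      = refl
  at-zero (x ∷ l) = refl

  at-map : ∀ (f : ℕ → ℕ) → f 0 ≡ 0 → ∀ w p → at (map f w) p ≡ f (at w p)
  at-map f f0 []      p             = sym f0
  at-map f f0 (x ∷ w) zero          = sym f0
  at-map f f0 (x ∷ w) (suc zero)    = refl
  at-map f f0 (x ∷ w) (suc (suc p)) = at-map f f0 w (suc p)

  All-at : ∀ {P : ℕ → Set} {w} → All P w → ∀ p → 1 ≤ p → p ≤ length w → P (at w p)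
  All-at (px ∷ pw) (suc zero)    _ _          = px
  All-at (px ∷ pw) (suc (suc p)) _ (s≤s p≤)   = All-at pw (suc p) (s≤s z≤n) p≤

  greaterAfter : List ℕ → ℕ → ℕ
  greaterAfter w p = above (at w p) (drop p w)

  -- Left multiplication by w∘ reverses values, so the inversions of w∘w starting
  -- at p are exactly the non-inversions of w starting at p.
  Inv-w₀∘ : ∀ {k w} → w ↭ idPerm k → ∀ p → 1 ≤ p → p ≤ suc k → Inv (w₀ k ∘ₗ w) p ≡ greaterAfter w p
  Inv-w₀∘ {k} {w} w↭id p 1≤p p≤ =
    trans (cong₂ (λ a l → length (filter (_<? a) l)) (at-map (at (w₀ k)) (at-zero (w₀ k)) w p) (drop-map p w))
          (below-image-reversed (at (w₀ k)) (at w p) (drop p w)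
             (All.map (w₀-reverses k wₚ∈) (drop⁺ p letters)))
    where
    letters : All (InRange k) w
    letters = perm-InRange w↭id
    wₚ∈ : InRange k (at w p)
    wₚ∈ = All-at letters p 1≤p (subst (p ≤_) (sym (perm-length w↭id)) p≤)

  zetaCol-in-range : ∀ k w i → i ≤ k → zetaCol k w i ≡ (k + 1 ∸ i) C 2 + Inv (w₀ k ∘ₗ w) i
  zetaCol-in-range k w i i≤k = cong (λ b → if b then (k + 1 ∸ i) C 2 + Inv (w₀ k ∘ₗ w) i else 0)
                                    (trans (isYes≗does (i ≤? k)) (dec-true (i ≤? k) i≤k))

  -- Consecutive binomial column lengths differ by L = k - i, so the number of
  -- parts i of ζ(w) is L + Inv_i(w∘w) - Inv_{i+1}(w∘w).
  zetaMult-Inv : ∀ k w i → i < k → zetaMult k w i ≡ (k ∸ i) + Inv (w₀ k ∘ₗ w) i ∸ Inv (w₀ k ∘ₗ w) (suc i)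
  zetaMult-Inv k w i i<k = begin
    zetaCol k w i ∸ zetaCol k w (suc i)
      ≡⟨ cong₂ _∸_ (zetaCol-in-range k w i (<⇒≤ i<k)) (zetaCol-in-range k w (suc i) i<k) ⟩
    ((k + 1 ∸ i) C 2 + a) ∸ ((k + 1 ∸ suc i) C 2 + b)
      ≡⟨ cong₂ (λ x y → (x C 2 + a) ∸ (y C 2 + b)) k+1-i≡ (cong (_∸ suc i) (+-comm k 1)) ⟩
    (suc L C 2 + a) ∸ (L C 2 + b)
      ≡⟨ cong (λ x → (x + a) ∸ (L C 2 + b)) Pascal ⟩
    (L + L C 2 + a) ∸ (L C 2 + b)
      ≡⟨ cong (_∸ (L C 2 + b)) (trans (cong (_+ a) (+-comm L (L C 2))) (+-assoc (L C 2) L a)) ⟩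
    (L C 2 + (L + a)) ∸ (L C 2 + b)
      ≡⟨ [m+n]∸[m+o]≡n∸o (L C 2) (L + a) b ⟩
    L + a ∸ b ∎
    where
    open ≡-Reasoning
    L a b : ℕ
    L = k ∸ i
    a = Inv (w₀ k ∘ₗ w) i
    b = Inv (w₀ k ∘ₗ w) (suc i)
    k+1-i≡ : k + 1 ∸ i ≡ suc L
    k+1-i≡ = trans (+-∸-comm 1 (<⇒≤ i<k)) (+-comm L 1)
    Pascal : suc L C 2 ≡ L + L C 2
    Pascal = trans (sym (nCk+nC[k+1]≡[n+1]C[k+1] L 1)) (cong (_+ L C 2) (nC1≡n L))

  thetaMult-Inv : ∀ k w i → i < k →
    thetaMult k w i ≡ ((k ∸ i) + Inv (w₀ k ∘ₗ w) i ∸ Inv (w₀ k ∘ₗ w) (suc i)) % suc (k ∸ i)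
  thetaMult-Inv k w i i<k = cong (_% suc (k ∸ i)) (zetaMult-Inv k w i i<k)

  drop-at : ∀ w p → suc p ≤ length w → drop p w ≡ at w (suc p) ∷ drop (suc p) w
  drop-at (x ∷ w) zero    _         = refl
  drop-at (x ∷ w) (suc p) (s≤s p<)  = drop-at w p p<

  adjacent-distinct : ∀ {w} → Unique w → ∀ p → 1 ≤ p → suc p ≤ length w → at w p ≢ at w (suc p)
  adjacent-distinct {x ∷ y ∷ w} ((x≢y ∷ _) ∷ _) (suc zero)    _ _         = x≢y
  adjacent-distinct {x ∷ w}     (_ ∷ u)         (suc (suc p)) _ (s≤s p<)  = adjacent-distinct u (suc p) (s≤s z≤n) p<

  ascent-arith : ∀ L g h → h ≤ g → g ≤ L → + ((L + suc g ∸ h) % suc L) ≡ (+ suc g - + h) - 1ℤ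
  ascent-arith L g h h≤g g≤L = begin
    + ((L + suc g ∸ h) % suc L)    ≡⟨ cong (λ z → + (z % suc L)) regroup ⟩
    + (((g ∸ h) + suc L) % suc L)  ≡⟨ cong +_ ([m+n]%n≡m%n (g ∸ h) (suc L)) ⟩
    + ((g ∸ h) % suc L)            ≡⟨ cong +_ (m≤n⇒m%n≡m (≤-trans (m∸n≤m g h) g≤L)) ⟩
    + (g ∸ h)                      ≡⟨ sym (⊖-≥ z≤n) ⟩
    suc (g ∸ h) ⊖ 1                ≡⟨ sym (m-n≡m⊖n (suc (g ∸ h)) 1) ⟩
    + suc (g ∸ h) - 1ℤ             ≡⟨ cong (λ z → + z - 1ℤ) (sym (+-∸-assoc 1 h≤g)) ⟩
    + (suc g ∸ h) - 1ℤ             ≡⟨ cong (_- 1ℤ) (sym (⊖-≥ (m≤n⇒m≤1+n h≤g))) ⟩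
    (suc g ⊖ h) - 1ℤ               ≡⟨ cong (_- 1ℤ) (sym (m-n≡m⊖n (suc g) h)) ⟩
    (+ suc g - + h) - 1ℤ           ∎
    where
    open ≡-Reasoning
    regroup : L + suc g ∸ h ≡ (g ∸ h) + suc L
    regroup = trans (cong (_∸ h) (trans (+-comm L (suc g)) (sym (+-suc g L)))) (+-∸-comm (suc L) h≤g)

  descent-arith : ∀ L g h → g ≤ h → h ≤ L → + ((L + g ∸ h) % suc L) ≡ + L +ℤ (+ g - + h)
  descent-arith L g h g≤h h≤L = begin
    + ((L + g ∸ h) % suc L)  ≡⟨ cong +_ (m≤n⇒m%n≡m (≤-trans (∸-monoʳ-≤ (L + g) g≤h) (≤-reflexive (m+n∸n≡m L g)))) ⟩
    + (L + g ∸ h)            ≡⟨ sym (⊖-≥ (≤-trans h≤L (m≤m+n L g))) ⟩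
    (L + g) ⊖ h              ≡⟨ sym (m-n≡m⊖n (L + g) h) ⟩
    (+ L +ℤ + g) - + h       ≡⟨ +ℤ-assoc (+ L) (+ g) (- (+ h)) ⟩
    + L +ℤ (+ g - + h)       ∎
    where open ≡-Reasoning

  residue-ascent : ∀ {L x y} rest → length rest ≡ L → x < y →
    + ((L + above x (y ∷ rest) ∸ above y rest) % suc L) ≡ (+ above x (y ∷ rest) - + above y rest) - 1ℤ
  residue-ascent {L} {x} {y} rest len x<y rewrite above-∷-> rest x<y =
    ascent-arith L (above x rest) (above y rest) (above-antitone (<⇒≤ x<y) rest)
                 (≤-trans (above-≤-length x rest) (≤-reflexive len))

  residue-descent : ∀ {L x y} rest → length rest ≡ L → y < x →
    + ((L + above x (y ∷ rest) ∸ above y rest) % suc L) ≡ + L +ℤ (+ above x (y ∷ rest) - + above y rest)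
  residue-descent {L} {x} {y} rest len y<x rewrite above-∷-≯ rest (<-asym y<x) =
    descent-arith L (above x rest) (above y rest) (above-antitone (<⇒≤ y<x) rest)
                  (≤-trans (above-≤-length y rest) (≤-reflexive len))

  -- The multiplicity of i in θ(w)
  -- and both inversion numbers are counts within this window.
  module Window {k w} (w↭id : w ↭ idPerm k) {i} (1≤i : 1 ≤ i) (i<k : i < k) where

    x y : ℕ
    x = at w i
    y = at w (suc i)

    rest : List ℕ
    rest = drop (suc i) w

    i+1≤length : suc i ≤ length w
    i+1≤length = ≤-trans i<k (≤-trans (n≤1+n k) (≤-reflexive (sym (perm-length w↭id))))

    length-rest : length rest ≡ k ∸ i
    length-rest = trans (length-drop (suc i) w) (cong (_∸ suc i) (perm-length w↭id))

    Inv-i : Inv (w₀ k ∘ₗ w) i ≡ above x (y ∷ rest)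
    Inv-i = trans (Inv-w₀∘ w↭id i 1≤i (≤-trans (<⇒≤ i<k) (n≤1+n k))) (cong (above x) (drop-at w i i+1≤length))

    Inv-i+1 : Inv (w₀ k ∘ₗ w) (suc i) ≡ above y rest
    Inv-i+1 = Inv-w₀∘ w↭id (suc i) (s≤s z≤n) (≤-trans i<k (n≤1+n k))

    x≢y : x ≢ y
    x≢y = adjacent-distinct (perm-Unique w↭id) i 1≤i i+1≤length

    thetaMult-window : + thetaMult k w i ≡ + (((k ∸ i) + above x (y ∷ rest) ∸ above y rest) % suc (k ∸ i))
    thetaMult-window = cong +_ (trans (thetaMult-Inv k w i i<k)
                                      (cong₂ (λ a b → ((k ∸ i) + a ∸ b) % suc (k ∸ i)) Inv-i Inv-i+1))

    theta-ascent : ¬ Desc w i → + thetaMult k w i ≡ (+ Inv (w₀ k ∘ₗ w) i - + Inv (w₀ k ∘ₗ w) (suc i)) - 1ℤ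
    theta-ascent y≮x = begin
      + thetaMult k w i                                                ≡⟨ thetaMult-window ⟩
      + (((k ∸ i) + above x (y ∷ rest) ∸ above y rest) % suc (k ∸ i))  ≡⟨ residue-ascent rest length-rest x<y ⟩
      (+ above x (y ∷ rest) - + above y rest) - 1ℤ                     ≡⟨ cong₂ (λ a b → (+ a - + b) - 1ℤ) (sym Inv-i) (sym Inv-i+1) ⟩
      (+ Inv (w₀ k ∘ₗ w) i - + Inv (w₀ k ∘ₗ w) (suc i)) - 1ℤ         ∎
      where
      open ≡-Reasoning
      x<y : x < y
      x<y = ≤∧≢⇒< (≮⇒≥ y≮x) x≢y

    theta-descent : Desc w i → + thetaMult k w i ≡ + (k ∸ i) +ℤ (+ Inv (w₀ k ∘ₗ w) i - + Inv (w₀ k ∘ₗ w) (suc i))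
    theta-descent y<x = begin
      + thetaMult k w i                                                ≡⟨ thetaMult-window ⟩
      + (((k ∸ i) + above x (y ∷ rest) ∸ above y rest) % suc (k ∸ i))  ≡⟨ residue-descent rest length-rest y<x ⟩
      + (k ∸ i) +ℤ (+ above x (y ∷ rest) - + above y rest)             ≡⟨ cong₂ (λ a b → + (k ∸ i) +ℤ (+ a - + b)) (sym Inv-i) (sym Inv-i+1) ⟩
      + (k ∸ i) +ℤ (+ Inv (w₀ k ∘ₗ w) i - + Inv (w₀ k ∘ₗ w) (suc i))  ∎
      where open ≡-Reasoning

  rotate : List ℕ → List ℕ
  rotate []      = []
  rotate (z ∷ s) = s ++ [ z ]

  rotateBy : ℕ → List ℕ → List ℕ
  rotateBy zero    l = l
  rotateBy (suc r) l = rotateBy r (rotate l)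

  rotateBy-++ : ∀ P Q → rotateBy (length P) (P ++ Q) ≡ Q ++ P
  rotateBy-++ []      Q = sym (++-identityʳ Q)
  rotateBy-++ (p ∷ P) Q = trans (cong (rotateBy (length P)) (++-assoc P Q [ p ]))
                                (trans (rotateBy-++ P (Q ++ [ p ])) (++-assoc Q [ p ] P))

  rotateBy-↭ : ∀ r l → rotateBy r l ↭ l
  rotateBy-↭ zero    l       = ↭-refl
  rotateBy-↭ (suc r) []      = rotateBy-↭ r []
  rotateBy-↭ (suc r) (z ∷ s) = ↭-trans (rotateBy-↭ r (s ++ [ z ])) (++-comm s [ z ])

  length-rotateBy : ∀ r l → length (rotateBy r l) ≡ length l
  length-rotateBy r l = ↭-length (rotateBy-↭ r l)

  -- By evalWord-factWord this is how c_k^{m_0} c_{k-1}^{m_1} ⋯ c_1^{m_{k-1}} acts.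
  mutual
    cascade : ℕ → (ℕ → ℕ) → List ℕ → List ℕ
    cascade zero    f L = L
    cascade (suc n) f L = keepHead n f (rotateBy (f 0) L)

    keepHead : ℕ → (ℕ → ℕ) → List ℕ → List ℕ
    keepHead n f []      = []
    keepHead n f (x ∷ T) = x ∷ cascade n (f ∘ suc) T

  cascade-step : ∀ n f {L x T} → rotateBy (f 0) L ≡ x ∷ T → cascade (suc n) f L ≡ x ∷ cascade n (f ∘ suc) T
  cascade-step n f first = cong (keepHead n f) first

  mutual
    cascade-↭ : ∀ n f L → cascade n f L ↭ L
    cascade-↭ zero    f L = ↭-refl
    cascade-↭ (suc n) f L = ↭-trans (keepHead-↭ n f (rotateBy (f 0) L)) (rotateBy-↭ (f 0) L)

    keepHead-↭ : ∀ n f L → keepHead n f L ↭ L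
    keepHead-↭ n f []      = ↭-refl
    keepHead-↭ n f (x ∷ T) = prep x (cascade-↭ n (f ∘ suc) T)

  mutual
    cascade-cong : ∀ n {f g} → (∀ t → f t ≡ g t) → ∀ L → cascade n f L ≡ cascade n g L
    cascade-cong zero    f≗g L = refl
    cascade-cong (suc n) {g = g} f≗g L rewrite f≗g 0 = keepHead-cong n f≗g (rotateBy (g 0) L)

    keepHead-cong : ∀ n {f g} → (∀ t → f t ≡ g t) → ∀ L → keepHead n f L ≡ keepHead n g L
    keepHead-cong n f≗g []      = refl
    keepHead-cong n f≗g (x ∷ T) = cong (x ∷_) (cascade-cong n (f≗g ∘ suc) T)

  applyWord : List ℕ → List ℕ → List ℕ
  applyWord w ws = foldl (λ v a → swapAt a v) w ws

  length-snoc : ∀ (pre : List ℕ) s → length (pre ++ [ s ]) ≡ suc (length pre)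
  length-snoc pre s = trans (length-++ pre) (+-comm (length pre) 1)

  swapAt-++ : ∀ pre a b rest → swapAt (suc (length pre)) (pre ++ a ∷ b ∷ rest) ≡ pre ++ b ∷ a ∷ rest
  swapAt-++ []           a b rest = refl
  swapAt-++ (p ∷ [])     a b rest = refl
  swapAt-++ (p ∷ q ∷ pre) a b rest = cong (p ∷_) (swapAt-++ (q ∷ pre) a b rest)

  bubble : ∀ n pre z S → length S ≡ n → applyWord (pre ++ z ∷ S) (range (suc (length pre)) n) ≡ pre ++ S ++ [ z ]
  bubble zero    pre z []      _   = refl
  bubble (suc n) pre z (s ∷ S) len = begin
    applyWord (swapAt (suc (length pre)) (pre ++ z ∷ s ∷ S)) (range (suc (suc (length pre))) n)
      ≡⟨ cong (λ v → applyWord v (range (suc (suc (length pre))) n)) (swapAt-++ pre z s S) ⟩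
    applyWord (pre ++ s ∷ z ∷ S) (range (suc (suc (length pre))) n)
      ≡⟨ cong₂ (λ v p → applyWord v (range (suc p) n)) (sym (++-assoc pre [ s ] (z ∷ S))) (sym (length-snoc pre s)) ⟩
    applyWord ((pre ++ [ s ]) ++ z ∷ S) (range (suc (length (pre ++ [ s ]))) n)
      ≡⟨ bubble n (pre ++ [ s ]) z S (suc-injective len) ⟩
    (pre ++ [ s ]) ++ S ++ [ z ]
      ≡⟨ ++-assoc pre [ s ] (S ++ [ z ]) ⟩
    pre ++ s ∷ S ++ [ z ] ∎
    where open ≡-Reasoning

  cWord-range : ∀ k j → j ≤ k → cWord k (k ∸ j) ≡ range (suc j) (k ∸ j)
  cWord-range k j j≤k = trans (map-upTo (λ t → (k + 1 ∸ (k ∸ j)) + t) (k ∸ j))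
                              (applyUpTo-range _ (suc j) (k ∸ j) (λ t → cong (_+ t) start))
    where
    start : k + 1 ∸ (k ∸ j) ≡ suc j
    start = trans (+-∸-comm 1 (m∸n≤m k j)) (trans (cong (_+ 1) (m∸[m∸n]≡n j≤k)) (+-comm j 1))

  module Evaluation (k : ℕ) (m : ℕ → ℕ) where

    c-rotates : ∀ n pre L → length pre + n ≡ k → length L ≡ suc n →
      applyWord (pre ++ L) (cWord k (k ∸ length pre)) ≡ pre ++ rotate L
    c-rotates n pre (z ∷ S) p+n≡k len = begin
      applyWord (pre ++ z ∷ S) (cWord k (k ∸ length pre))
        ≡⟨ cong (applyWord (pre ++ z ∷ S)) (cWord-range k (length pre) (≤-trans (m≤m+n (length pre) n) (≤-reflexive p+n≡k))) ⟩
      applyWord (pre ++ z ∷ S) (range (suc (length pre)) (k ∸ length pre))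
        ≡⟨ cong (λ t → applyWord (pre ++ z ∷ S) (range (suc (length pre)) t))
                (trans (cong (_∸ length pre) (sym p+n≡k)) (m+n∸m≡n (length pre) n)) ⟩
      applyWord (pre ++ z ∷ S) (range (suc (length pre)) n)
        ≡⟨ bubble n pre z S (suc-injective len) ⟩
      pre ++ S ++ [ z ] ∎
      where open ≡-Reasoning

    cPower-rotates : ∀ r n pre L → length pre + n ≡ k → length L ≡ suc n →
      applyWord (pre ++ L) (concat (replicate r (cWord k (k ∸ length pre)))) ≡ pre ++ rotateBy r L
    cPower-rotates zero    n pre L p+n≡k len = refl
    cPower-rotates (suc r) n pre L p+n≡k len = begin
      applyWord (pre ++ L) (c ++ concat (replicate r c))
        ≡⟨ foldl-++ (λ v a → swapAt a v) (pre ++ L) c (concat (replicate r c)) ⟩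
      applyWord (applyWord (pre ++ L) c) (concat (replicate r c))
        ≡⟨ cong (λ v → applyWord v (concat (replicate r c))) (c-rotates n pre L p+n≡k len) ⟩
      applyWord (pre ++ rotate L) (concat (replicate r c))
        ≡⟨ cPower-rotates r n pre (rotate L) p+n≡k (trans (length-rotateBy 1 L) len) ⟩
      pre ++ rotateBy r (rotate L) ∎
      where
      open ≡-Reasoning
      c : List ℕ
      c = cWord k (k ∸ length pre)

    block : ℕ → List ℕ
    block j = concat (replicate (m j) (cWord k (k ∸ j)))

    blocks-cascade : ∀ n pre L → length pre + n ≡ k → length L ≡ suc n →
      applyWord (pre ++ L) (concat (map block (range (length pre) n))) ≡ pre ++ cascade n (λ t → m (t + length pre)) L
    blocks-cascade zero    pre L p+n≡k len = refl
    blocks-cascade (suc n) pre L p+n≡k len = begin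
      applyWord (pre ++ L) (block (length pre) ++ later)
        ≡⟨ foldl-++ (λ v a → swapAt a v) (pre ++ L) (block (length pre)) later ⟩
      applyWord (applyWord (pre ++ L) (block (length pre))) later
        ≡⟨ cong (λ v → applyWord v later) (cPower-rotates (m (length pre)) (suc n) pre L p+n≡k len) ⟩
      applyWord (pre ++ rotateBy (m (length pre)) L) later
        ≡⟨ after-first (rotateBy (m (length pre)) L) (trans (length-rotateBy (m (length pre)) L) len) ⟩
      pre ++ keepHead n (λ t → m (t + length pre)) (rotateBy (m (length pre)) L) ∎
      where
      open ≡-Reasoning
      later : List ℕ
      later = concat (map block (range (suc (length pre)) n))
      -- past the first block the fixed entry joins pre and the cascade continues on the rest
      after-first : ∀ R → length R ≡ suc (suc n) → applyWord (pre ++ R) later ≡ pre ++ keepHead n (λ t → m (t + length pre)) R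
      after-first (x ∷ T) lenR = begin
        applyWord (pre ++ x ∷ T) later
          ≡⟨ cong₂ (λ v p → applyWord v (concat (map block (range p n)))) (sym (++-assoc pre [ x ] T)) (sym (length-snoc pre x)) ⟩
        applyWord ((pre ++ [ x ]) ++ T) (concat (map block (range (length (pre ++ [ x ])) n)))
          ≡⟨ blocks-cascade n (pre ++ [ x ]) T p+1+n≡k (suc-injective lenR) ⟩
        (pre ++ [ x ]) ++ cascade n (λ t → m (t + length (pre ++ [ x ]))) T
          ≡⟨ ++-assoc pre [ x ] _ ⟩
        pre ++ x ∷ cascade n (λ t → m (t + length (pre ++ [ x ]))) T
          ≡⟨ cong (λ C → pre ++ x ∷ C) (cascade-cong n shift T) ⟩
        pre ++ x ∷ cascade n (λ t → m (suc t + length pre)) T ∎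
        where
        p+1+n≡k : length (pre ++ [ x ]) + n ≡ k
        p+1+n≡k = trans (cong (_+ n) (length-snoc pre x)) (trans (sym (+-suc (length pre) n)) p+n≡k)
        shift : ∀ t → m (t + length (pre ++ [ x ])) ≡ m (suc t + length pre)
        shift t = cong m (trans (cong (_+_ t) (length-snoc pre x)) (+-suc t (length pre)))

  evalWord-factWord : ∀ k m → evalWord k (factWord k m) ≡ cascade k m (idPerm k)
  evalWord-factWord k m = begin
    applyWord (idPerm k) (concat (map block (upTo k)))
      ≡⟨ cong (λ js → applyWord (idPerm k) (concat (map block js))) (applyUpTo-range (λ t → t) 0 k (λ t → refl)) ⟩
    applyWord ([] ++ idPerm k) (concat (map block (range 0 k)))
      ≡⟨ blocks-cascade k [] (idPerm k) refl (perm-length ↭-refl) ⟩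
    cascade k (λ t → m (t + 0)) (idPerm k)
      ≡⟨ cascade-cong k (λ t → cong m (+-identityʳ t)) (idPerm k) ⟩
    cascade k m (idPerm k) ∎
    where
    open ≡-Reasoning
    open Evaluation k m

  RotatedSorted : List ℕ → Set
  RotatedSorted L = Σ[ A ∈ List ℕ ] Σ[ B ∈ List ℕ ]
    (L ≡ A ++ B × Increasing A × Increasing B × All (λ b → All (b <_) A) B)

  -- T lists its entries in increasing cyclic order starting just above x:
  -- T = A ++ B, A increasing and above x, B increasing and below x.
  SortedAfter : ℕ → List ℕ → Set
  SortedAfter x T = Σ[ A ∈ List ℕ ] Σ[ B ∈ List ℕ ]
    (T ≡ A ++ B × Increasing A × Increasing B × All (x <_) A × All (_< x) B × All (λ b → All (b <_) A) B)

  idPerm-rotatedSorted : ∀ k → RotatedSorted (idPerm k)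
  idPerm-rotatedSorted k =
    idPerm k , [] , sym (++-identityʳ _) , subst Increasing (sym (idPerm-range k)) (range-increasing 1 (suc k)) , [] , []

  sortedAfter-head : ∀ {x T} → RotatedSorted (x ∷ T) → SortedAfter x T
  sortedAfter-head ([] , _ , refl , _ , (x<T ∷ incT) , _) = _ , [] , sym (++-identityʳ _) , incT , [] , x<T , [] , []
  sortedAfter-head ((a ∷ A) , B , refl , (a<A ∷ incA) , incB , B<aA) =
    A , B , refl , incA , incB , a<A , All.map (λ { (b<a ∷ _) → b<a }) B<aA , All.map (λ { (_ ∷ b<A) → b<A }) B<aA

  sortedAfter-rotatedSorted : ∀ {x T} → SortedAfter x T → RotatedSorted T
  sortedAfter-rotatedSorted (A , B , T≡ , incA , incB , _ , _ , B<A) = A , B , T≡ , incA , incB , B<A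

  -- rotating moves the head x to the end of the lower part, which it exceeds
  rotate-rotatedSorted : ∀ {L} → RotatedSorted L → RotatedSorted (rotate L)
  rotate-rotatedSorted {[]}    sorted = sorted
  rotate-rotatedSorted {z ∷ s} sorted with sortedAfter-head sorted
  ... | A , B , refl , incA , incB , z<A , B<z , B<A =
    A , B ++ [ z ] , ++-assoc A B [ z ] , incA ,
    AllPairs.++⁺ incB ([] ∷ []) (All.map (λ b<z → b<z ∷ []) B<z) ,
    All-++⁺ B<A (z<A ∷ [])

  rotateBy-rotatedSorted : ∀ r {L} → RotatedSorted L → RotatedSorted (rotateBy r L)
  rotateBy-rotatedSorted zero    sorted = sorted
  rotateBy-rotatedSorted (suc r) sorted = rotateBy-rotatedSorted r (rotate-rotatedSorted sorted)

  rotateBy-sortedAfter : ∀ {n} r {L} → RotatedSorted L → length L ≡ suc n →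
    Σ[ x ∈ ℕ ] Σ[ T ∈ List ℕ ] (rotateBy r L ≡ x ∷ T × SortedAfter x T × length T ≡ n)
  rotateBy-sortedAfter r {L} sorted len with rotateBy r L | rotateBy-rotatedSorted r sorted | length-rotateBy r L
  ... | []    | _       | len′ = contradiction (trans len′ len) 0≢1+n
  ... | x ∷ T | sorted′ | len′ = x , T , refl , sortedAfter-head sorted′ , suc-injective (trans len′ len)

  split-at : ∀ r (A : List ℕ) → r < length A →
    Σ[ A1 ∈ List ℕ ] Σ[ y ∈ ℕ ] Σ[ A2 ∈ List ℕ ] (A ≡ A1 ++ y ∷ A2 × length A1 ≡ r)
  split-at zero    (a ∷ A) _        = [] , a , A , refl , refl
  split-at (suc r) (a ∷ A) (s≤s r<) with split-at r A r<
  ... | A1 , y , A2 , refl , refl = a ∷ A1 , y , A2 , refl , refl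

  All-middle : ∀ {P : ℕ → Set} A1 {y A2} → All P (A1 ++ y ∷ A2) → P y
  All-middle []       (py ∷ _) = py
  All-middle (a ∷ A1) (_ ∷ ps) = All-middle A1 ps

  increasing-split : ∀ A1 {y A2} → Increasing (A1 ++ y ∷ A2) → All (_< y) A1 × All (y <_) A2
  increasing-split []       (y<A2 ∷ _)   = [] , y<A2
  increasing-split (a ∷ A1) (a<  ∷ inc) with increasing-split A1 inc
  ... | A1<y , y<A2 = All-middle A1 a< ∷ A1<y , y<A2

  above-split : ∀ {x A B} → All (x <_) A → All (_< x) B → above x (A ++ B) ≡ length A
  above-split {x} {A} {B} x<A B<x =
    trans (above-++ x A B) (trans (cong₂ _+_ (above-all x<A) (above-none B<x)) (+-identityʳ (length A)))

  rotate-into-upper : ∀ A1 y A2 B → rotateBy (length A1) ((A1 ++ y ∷ A2) ++ B) ≡ y ∷ (A2 ++ B) ++ A1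
  rotate-into-upper A1 y A2 B = trans (cong (rotateBy (length A1)) (++-assoc A1 (y ∷ A2) B)) (rotateBy-++ A1 (y ∷ A2 ++ B))

  rotate-into-lower : ∀ A B1 y B2 → rotateBy (length A + length B1) (A ++ B1 ++ y ∷ B2) ≡ y ∷ B2 ++ (A ++ B1)
  rotate-into-lower A B1 y B2 = trans (cong₂ rotateBy (sym (length-++ A)) (sym (++-assoc A B1 (y ∷ B2))))
                                      (rotateBy-++ (A ++ B1) (y ∷ B2))

  -- A rotation by r ≤ n that lands in the upper part A = A1 ++ y ∷ A2 (r = |A1|):
  -- the entries after y that exceed it are exactly A2.
  offset-upper : ∀ {n A1 y A2 B z T'} → Increasing (A1 ++ y ∷ A2) → All (λ b → All (b <_) (A1 ++ y ∷ A2)) B →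
    length A1 ≤ n → rotateBy (length A1) ((A1 ++ y ∷ A2) ++ B) ≡ z ∷ T' →
    (n + length (A1 ++ y ∷ A2) ∸ above z T') % suc n ≡ length A1
  offset-upper {n} {A1} {y} {A2} {B} inc B<A r≤n rot with ∷-injective (trans (sym rot) (rotate-into-upper A1 y A2 B))
  ... | refl , refl = begin
    (n + length (A1 ++ y ∷ A2) ∸ above y ((A2 ++ B) ++ A1)) % suc n
      ≡⟨ cong₂ (λ a b → (n + a ∸ b) % suc n) (length-++ A1) above-y ⟩
    (n + (length A1 + suc (length A2)) ∸ length A2) % suc n
      ≡⟨ cong (λ z → (z ∸ length A2) % suc n) (regroup n (length A1) (length A2)) ⟩
    ((length A1 + suc n) + length A2 ∸ length A2) % suc n
      ≡⟨ cong (_% suc n) (m+n∸n≡m (length A1 + suc n) (length A2)) ⟩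
    (length A1 + suc n) % suc n
      ≡⟨ [m+n]%n≡m%n (length A1) (suc n) ⟩
    length A1 % suc n
      ≡⟨ m≤n⇒m%n≡m r≤n ⟩
    length A1 ∎
    where
    open ≡-Reasoning
    above-y : above y ((A2 ++ B) ++ A1) ≡ length A2
    above-y = trans (above-++ y (A2 ++ B) A1)
              (trans (cong₂ _+_ (above-split (proj₂ (increasing-split A1 inc)) (All.map (All-middle A1) B<A))
                                (above-none (proj₁ (increasing-split A1 inc))))
                     (+-identityʳ (length A2)))
    regroup : ∀ a b c → a + (b + suc c) ≡ (b + suc a) + c
    regroup = solve-∀

  -- A rotation by r ≤ n that lands in the lower part B = B1 ++ y ∷ B2 (r = |A| + |B1|):
  -- the entries after y that exceed it are B2 and all of A.
  offset-lower : ∀ {n A B1 y B2 z T'} r → Increasing (B1 ++ y ∷ B2) → All (λ b → All (b <_) A) (B1 ++ y ∷ B2) →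
    length (A ++ B1 ++ y ∷ B2) ≡ suc n → r ≡ length A + length B1 → rotateBy r (A ++ B1 ++ y ∷ B2) ≡ z ∷ T' →
    (n + length A ∸ above z T') % suc n ≡ r
  offset-lower {n} {A} {B1} {y} {B2} _ inc B<A len refl rot with ∷-injective (trans (sym rot) (rotate-into-lower A B1 y B2))
  ... | refl , refl = begin
    (n + length A ∸ above y (B2 ++ (A ++ B1))) % suc n
      ≡⟨ cong₂ (λ z b → (z + length A ∸ b) % suc n) n≡ above-y ⟩
    (length A + length B1 + length B2 + length A ∸ (length B2 + length A)) % suc n
      ≡⟨ cong (λ z → (z ∸ (length B2 + length A)) % suc n) (+-assoc (length A + length B1) (length B2) (length A)) ⟩
    (length A + length B1 + (length B2 + length A) ∸ (length B2 + length A)) % suc n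
      ≡⟨ cong (_% suc n) (m+n∸n≡m (length A + length B1) (length B2 + length A)) ⟩
    (length A + length B1) % suc n
      ≡⟨ m≤n⇒m%n≡m (≤-trans (m≤m+n (length A + length B1) (length B2)) (≤-reflexive (sym n≡))) ⟩
    length A + length B1 ∎
    where
    open ≡-Reasoning
    above-y : above y (B2 ++ (A ++ B1)) ≡ length B2 + length A
    above-y = trans (above-++ y B2 (A ++ B1))
                    (cong₂ _+_ (above-all (proj₂ (increasing-split B1 inc)))
                               (above-split (All-middle B1 B<A) (proj₁ (increasing-split B1 inc))))
    count : ∀ a b c → a + (b + suc c) ≡ suc (a + b + c)
    count = solve-∀
    n≡ : n ≡ length A + length B1 + length B2
    n≡ = suc-injective (trans (sym len) (trans (length-++ A) (trans (cong (_+_ (length A)) (length-++ B1))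
                                                                  (count (length A) (length B1) (length B2)))))

  index-in-lower : ∀ {r n a b} → ¬ r < a → r ≤ n → a + b ≡ suc n → r ∸ a < b
  index-in-lower {r} {n} {a} {b} r≮a r≤n a+b≡ =
    +-cancelˡ-< a (r ∸ a) b (subst₂ _<_ (sym (m+[n∸m]≡n (≮⇒≥ r≮a))) (sym a+b≡) (s≤s r≤n))

  cyclic-offset : ∀ {n x T y T'} r → SortedAfter x T → length T ≡ suc n → r ≤ n → rotateBy r T ≡ y ∷ T' →
    (n + above x T ∸ above y T') % suc n ≡ r
  cyclic-offset r (A , B , refl , incA , incB , x<A , B<x , B<A) len r≤n rot
    rewrite above-split x<A B<x with r <? length A
  ... | yes r<A with split-at r A r<A
  ...   | A1 , y0 , A2 , refl , refl = offset-upper incA B<A r≤n rot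
  cyclic-offset r (A , B , refl , incA , incB , x<A , B<x , B<A) len r≤n rot
      | no r≮A with split-at (r ∸ length A) B (index-in-lower r≮A r≤n (trans (sym (length-++ A)) len))
  ...   | B1 , y0 , B2 , refl , B1≡ =
    offset-lower r incB B<A len (trans (sym (m+[n∸m]≡n (≮⇒≥ r≮A))) (cong (_+_ (length A)) (sym B1≡))) rot

  residue : ℕ → List ℕ → ℕ → ℕ
  residue n v p = ((n ∸ p) + greaterAfter v p ∸ greaterAfter v (suc p)) % suc (n ∸ p)

  thetaMult-residue : ∀ {k w} → w ↭ idPerm k → ∀ i → 1 ≤ i → i < k → thetaMult k w i ≡ residue k w i
  thetaMult-residue {k} {w} w↭id i 1≤i i<k =
    trans (thetaMult-Inv k w i i<k)
          (cong₂ (λ a b → ((k ∸ i) + a ∸ b) % suc (k ∸ i))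
                 (Inv-w₀∘ w↭id i 1≤i (≤-trans (<⇒≤ i<k) (n≤1+n k)))
                 (Inv-w₀∘ w↭id (suc i) (s≤s z≤n) (≤-trans i<k (n≤1+n k))))

  -- At position 1 of x ∷ cascade, with the rest sorted after x, the residue is
  -- the first exponent: the cascade's first rotation is by f 0.
  residue-head : ∀ n f {x T} → SortedAfter x T → length T ≡ suc (suc n) → f 0 ≤ suc n →
    residue (suc (suc n)) (x ∷ cascade (suc n) f T) 1 ≡ f 0
  residue-head n f {x} {T} sorted len f0≤ with rotateBy-sortedAfter (f 0) (sortedAfter-rotatedSorted sorted) len
  ... | y , T' , first , _ , _ rewrite cascade-step n f first = begin
    (suc n + above x (y ∷ cascade n (f ∘ suc) T') ∸ above y (cascade n (f ∘ suc) T')) % suc (suc n)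
      ≡⟨ cong₂ (λ a b → (suc n + a ∸ b) % suc (suc n)) above-x above-y ⟩
    (suc n + above x T ∸ above y T') % suc (suc n)
      ≡⟨ cyclic-offset (f 0) sorted len f0≤ first ⟩
    f 0 ∎
    where
    open ≡-Reasoning
    above-x : above x (y ∷ cascade n (f ∘ suc) T') ≡ above x T
    above-x = above-↭ x (↭-trans (prep y (cascade-↭ n (f ∘ suc) T'))
                                 (subst (_↭ T) first (rotateBy-↭ (f 0) T)))
    above-y : above y (cascade n (f ∘ suc) T') ≡ above y T'
    above-y = above-↭ y (cascade-↭ n (f ∘ suc) T')

  residue-cascade : ∀ n f L → RotatedSorted L → length L ≡ suc n → (∀ t → t < n → f t ≤ n ∸ t) →
    ∀ p → 1 ≤ p → p < n → residue n (cascade n f L) p ≡ f p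
  residue-cascade (suc (suc n)) f L sorted len bound (suc zero) _ _
    with rotateBy-sortedAfter (f 0) sorted len
  ... | x , T , first , after , lenT rewrite cascade-step (suc n) f first =
    residue-head n (f ∘ suc) after lenT (bound 1 (s≤s (s≤s z≤n)))
  residue-cascade (suc n) f L sorted len bound (suc (suc p)) _ (s≤s p<n)
    with rotateBy-sortedAfter (f 0) sorted len
  ... | x , T , first , after , lenT rewrite cascade-step n f first =
    residue-cascade n (f ∘ suc) T (sortedAfter-rotatedSorted after) lenT (λ t t<n → bound (suc t) (s≤s t<n))
                    (suc p) (s≤s z≤n) p<n

  theta-factorization : ∀ {k w} → w ↭ idPerm k → ∀ i → 1 ≤ i → i < k →
    (m : ℕ → ℕ) → (∀ j → j < k → m j ≤ k ∸ j) → w ≡ evalWord k (factWord k m) → thetaMult k w i ≡ m i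
  theta-factorization {k} w↭id i 1≤i i<k m bound refl = begin
    thetaMult k (evalWord k (factWord k m)) i    ≡⟨ thetaMult-residue w↭id i 1≤i i<k ⟩
    residue k (evalWord k (factWord k m)) i      ≡⟨ cong (λ v → residue k v i) (evalWord-factWord k m) ⟩
    residue k (cascade k m (idPerm k)) i         ≡⟨ residue-cascade k m (idPerm k) (idPerm-rotatedSorted k) (perm-length ↭-refl) bound i 1≤i i<k ⟩
    m i                                          ∎
    where open ≡-Reasoning

open import Defs
open import Data.Nat using (ℕ; suc; _≤_; _<_; _∸_)
open import Data.Integer using (+_; _-_; _+_; 1ℤ)
open import Data.List using (List)
open import Data.List.Relation.Binary.Permutation.Propositional using (_↭_)
open import Data.Product using (_×_; _,_)
open import Relation.Nullary using (¬_)
open import Relation.Binary.PropositionalEquality using (_≡_)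
open Lemmas using (module Window; theta-factorization)

lemma7p3 : (k : ℕ) → 1 ≤ k → (w : List ℕ) → w ↭ idPerm k →
    (i : ℕ) → 1 ≤ i → i < k →
    ((¬ Desc w i → + thetaMult k w i ≡ (+ Inv (w₀ k ∘ₗ w) i - + Inv (w₀ k ∘ₗ w) (suc i)) - 1ℤ)
    × (Desc w i → + thetaMult k w i ≡ + (k ∸ i) + (+ Inv (w₀ k ∘ₗ w) i - + Inv (w₀ k ∘ₗ w) (suc i))))
    × ((m : ℕ → ℕ) → ((j : ℕ) → j < k → m j ≤ k ∸ j) → w ≡ evalWord k (factWord k m) →
    thetaMult k w i ≡ m i)
lemma7p3 k _ w w↭id i 1≤i i<k =
  (theta-ascent , theta-descent) , theta-factorization w↭id i 1≤i i<k
  where open Window w↭id 1≤i i<k
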